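{- Let $n\ge 1$, $\alpha(n)\ge 1$, and let $H$ be a connected graph which is an induced subgraph of some graph on $n$ vertices. Let $(S,V(H)\setminus S)$ be a $2/3$-balanced cut of $H$ whose set $F$ of crossing edges satisfies $|F|\le \alpha(n)\cdot b(H)$. Let $C_1,\dots,C_k$ be the connected components of $H$ with the edges of $F$ removed, let $T_i$ be a spanning tree of $C_i$ for each $i$, and let $T$ be a spanning tree of $H$ obtained by connecting the trees $T_1,\dots,T_k$ by edges of $F$ (so $E(T)\subseteq \bigcup_i E(T_i)\cup F$ and $E(T_i)\subseteq E(T)$). Then $$c(H,T)\le \max_i c(C_i,T_i) + \alpha(n)\cdot b(H).$$
   Context: For a connected graph $G$ and a spanning tree $T$ of $G$: for a tree edge $uv$, let $S_u,S_v$ be the vertex sets of the two components of $T$ minus $uv$; the congestion $c(uv)$ is the number of edges of $G$ between $S_u$ and $S_v$, and $c(G,T)=\max_{e\in E(T)}c(e)$. For a graph consisting of a single vertex and no edges (whose only spanning tree is itself), the congestion is defined to be $0$. A $2/3$-balanced cut of a graph on $m$ vertices is a partition of its vertex set into two sets each of size at most $2m/3$. A bisection of a graph on $m$ vertices is a partition of its vertices into two sets each of size at most $\lceil m/2\rceil$; $b(H)$ is the minimum number of edges crossing a bisection of $H$. (In the paper, $H$ is the subgraph at a node of the recursive decomposition produced by the algorithm, $F$ is the cut computed there by an algorithm with pseudo-approximation factor $\alpha(n)$, and $T_i$ are the recursively constructed trees.)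
   Formalization: The factor $\alpha(n)$ takes values in the rationals. -}

module Defs where

open import Data.Nat using (ℕ; zero; suc; _≤_; _<_; _∸_; _⊔_; _*_; ⌈_/2⌉)
open import Data.Bool using (Bool; true; false; _∧_; _∨_; not; if_then_else_; _xor_)
open import Data.Fin using (Fin; toℕ; _≟_)
open import Data.Fin.Properties using ()
open import Data.List using (List; []; _∷_; _++_; [_]; length; map; foldr)
open import Data.Nat.ListAction using (sum)
open import Data.Bool.ListAction using (any)
open import Data.List.Relation.Unary.Linked using (Linked)
open import Data.List.Relation.Unary.Unique.Propositional using (Unique)
open import Data.Product using (Σ; _×_; ∃)
open import Data.Empty using (⊥)
open import Function.Definitions using (Injective)
open import Relation.Binary.PropositionalEquality using (_≡_)
open import Relation.Nullary using (¬_)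
open import Relation.Nullary.Decidable using (⌊_⌋)
open import Data.Nat.Base using (_<ᵇ_)
open import Data.List.Base using (allFin)

record Graph (m : ℕ) : Set where
  field
    adj    : Fin m → Fin m → Bool
    sym    : ∀ i j → adj i j ≡ adj j i
    irrefl : ∀ i → adj i i ≡ false
open Graph public

VSet : ℕ → Set
VSet m = Fin m → Bool

ESet : ℕ → Set
ESet m = Fin m → Fin m → Bool

_⊆E_ : ∀ {m} → ESet m → ESet m → Set
E ⊆E E' = ∀ x y → E x y ≡ true → E' x y ≡ true

Symmetric : ∀ {m} → ESet m → Set
Symmetric E = ∀ x y → E x y ≡ E y x

size : ∀ {m} → VSet m → ℕ
size {m} A = sum (map (λ i → if A i then 1 else 0) (allFin m))

countPairs : ∀ {m} → (Fin m → Fin m → Bool) → ℕ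
countPairs {m} P =
  sum (map (λ i → sum (map (λ j → if (toℕ i <ᵇ toℕ j) ∧ P i j then 1 else 0)
                              (allFin m)))
           (allFin m))

numEdges : ∀ {m} → ESet m → ℕ
numEdges E = countPairs E

crossing : ∀ {m} → ESet m → VSet m → VSet m → ℕ
crossing E A B = countPairs (λ x y → E x y ∧ ((A x ∧ B y) ∨ (A y ∧ B x)))

reachIn : ∀ {m} → ℕ → ESet m → Fin m → Fin m → Bool
reachIn zero    E u v = ⌊ u ≟ v ⌋
reachIn {m} (suc k) E u v =
  reachIn k E u v ∨ any (λ w → reachIn k E u w ∧ E w v) (allFin m)

-- Reachability (walks of length ≤ m suffice on m vertices).
reach : ∀ {m} → ESet m → Fin m → Fin m → Bool
reach {m} E = reachIn m E

-- The graph (V , E) is connected (E is assumed to have its edges inside V).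
Connected : ∀ {m} → VSet m → ESet m → Set
Connected V E = ∀ u v → V u ≡ true → V v ≡ true → reach E u v ≡ true

IsCycle : ∀ {m} → ESet m → List (Fin m) → Set
IsCycle E [] = ⊥
IsCycle E (v ∷ ws) =
  (2 ≤ length ws) × Unique (v ∷ ws) × Linked (λ x y → E x y ≡ true) (v ∷ ws ++ [ v ])

Acyclic : ∀ {m} → ESet m → Set
Acyclic E = ∀ cs → ¬ IsCycle E cs

SpanningTree : ∀ {m} → VSet m → ESet m → ESet m → Set
SpanningTree V E T = Symmetric T × T ⊆E E × Connected V T × Acyclic T

removeEdge : ∀ {m} → ESet m → Fin m → Fin m → ESet m
removeEdge T i j x y =
  T x y ∧ not ((⌊ x ≟ i ⌋ ∧ ⌊ y ≟ j ⌋) ∨ (⌊ x ≟ j ⌋ ∧ ⌊ y ≟ i ⌋))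

edgeCongestion : ∀ {m} → ESet m → ESet m → Fin m → Fin m → ℕ
edgeCongestion E T u v =
  crossing E (reach (removeEdge T u v) u) (reach (removeEdge T u v) v)

maxList : List ℕ → ℕ
maxList = foldr _⊔_ 0

-- c(G , T) = max over tree edges of the congestion (0 if there are no tree edges).
congestion : ∀ {m} → ESet m → ESet m → ℕ
congestion {m} E T =
  maxList (map (λ u → maxList (map (λ v →
      if (toℕ u <ᵇ toℕ v) ∧ T u v then edgeCongestion E T u v else 0)
    (allFin m))) (allFin m))

allV : ∀ {m} → VSet m
allV _ = true

compl : ∀ {m} → VSet m → VSet m
compl A x = not (A x)

cutEdges : ∀ {m} → Graph m → VSet m → ESet m
cutEdges G S x y = adj G x y ∧ (S x xor S y)

Balanced23 : ∀ {m} → VSet m → Set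
Balanced23 {m} S = (3 * size S ≤ 2 * m) × (3 * (m ∸ size S) ≤ 2 * m)

Bisection : ∀ {m} → VSet m → Set
Bisection {m} S = (size S ≤ ⌈ m /2⌉) × (m ∸ size S ≤ ⌈ m /2⌉)

IsBisectionWidth : ∀ {m} → Graph m → ℕ → Set
IsBisectionWidth G b =
  (Σ _ λ S → Bisection S × numEdges (cutEdges G S) ≡ b)
  × (∀ S → Bisection S → b ≤ numEdges (cutEdges G S))

InducedSubgraphOf : ∀ {m n} → Graph m → Graph n → Set
InducedSubgraphOf {m} {n} H G =
  Σ (Fin m → Fin n) λ f → Injective _≡_ _≡_ f × (∀ i j → adj H i j ≡ adj G (f i) (f j))

minusEdges : ∀ {m} → Graph m → ESet m → ESet m
minusEdges H F x y = adj H x y ∧ not (F x y)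

restrictE : ∀ {m} → ESet m → VSet m → ESet m
restrictE E C x y = E x y ∧ C x ∧ C y

IsComponent : ∀ {m} → ESet m → VSet m → Set
IsComponent E C =
  (Σ _ λ x → C x ≡ true)
  × Connected C (restrictE E C)
  × (∀ x y → C x ≡ true → E x y ≡ true → C y ≡ true)

AreComponents : ∀ {m k} → ESet m → (Fin k → VSet m) → Set
AreComponents {m} {k} E C =
  (∀ i → IsComponent E (C i))
  × (∀ i j x → C i x ≡ true → C j x ≡ true → i ≡ j)
  × (∀ x → Σ (Fin k) λ i → C i x ≡ true)

-- Fix a tree edge uv of T and an edge xy of H crossing the cut of T − uv. If xy ∉ F, then x and y
-- lie in one component C_j, and the T_j-path joining them would connect the two sides of T − uv
-- unless it uses uv; so uv ∈ T_j, and xy crosses the cut of T_j − uv as well. Hence when uv ∈ F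
-- every crossing edge is in F, and when uv ∈ T_i every crossing edge is in F or counted by
-- c(C_i, T_i); either way c(uv) ≤ max_i c(C_i, T_i) + |F| ≤ max_i c(C_i, T_i) + α(n)·b(H).

module Submission where

open import Defs
open import Data.Nat using (ℕ; _≤_; zero; suc; z≤n; s≤s; _<ᵇ_)
import Data.Nat as ℕ
open import Data.Nat.Properties
  using ( ≤-refl; ≤-trans; ⊔-lub; m≤n⇒m≤n⊔o; m≤n⇒m≤o⊔n; +-mono-≤; +-monoˡ-≤; m≤n+m
        ; +-commutativeSemigroup; module ≤-Reasoning)
open import Data.Nat.ListAction using (sum)
open import Algebra.Properties.CommutativeSemigroup +-commutativeSemigroup using (interchange)
open import Data.Fin using (Fin; toℕ; _≟_)
open import Data.Bool using (Bool; true; false; _∧_; _∨_; not; if_then_else_) renaming (_≟_ to _≟ᵇ_)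
open import Data.Bool.Properties
  using (T-≡; ¬-not; ∧-conicalˡ; ∧-conicalʳ; ∧-identityʳ; ∧-comm; ∨-comm)
open import Data.Bool.ListAction using (any)
open import Data.List using (List; []; _∷_; _++_; [_]; map)
open import Data.List.Base using (allFin)
open import Data.List.Properties using (foldr-preservesᵇ; foldr-preservesᵒ)
open import Data.List.Relation.Unary.All using (All; []; universal)
open import Data.List.Relation.Unary.All.Properties using (map⁺; ¬Any⇒All¬)
open import Data.List.Relation.Unary.Any using (here; there; satisfied; any?)
open import Data.List.Relation.Unary.Any.Properties using (any⁺; any⁻)
open import Data.List.Relation.Unary.AllPairs using ([]; _∷_)
open import Data.List.Relation.Unary.Linked using (Linked; [-]; _∷_)
open import Data.List.Relation.Unary.Unique.Propositional using (Unique)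
open import Data.List.Membership.Propositional using (_∈_; lose)
open import Data.List.Membership.Propositional.Properties using (∈-map⁺; ∈-allFin)
open import Data.Integer using (+_)
import Data.Integer as ℤ
import Data.Integer.Properties as ℤ
open import Data.Rational using (ℚ; _/_; 1ℚ; _+_; _*_; toℚᵘ) renaming (_≤_ to _≤ℚ_)
import Data.Rational.Properties as ℚ
open import Data.Rational.Unnormalised using (mkℚᵘ; *≤*)
import Data.Rational.Unnormalised as ℚᵘ
import Data.Rational.Unnormalised.Properties as ℚᵘ
open import Data.Product using (Σ; ∃; _×_; _,_; proj₁; proj₂; uncurry)
import Data.Product as Prod
open import Data.Sum using (_⊎_; inj₁; inj₂; [_,_]′)
import Data.Sum as Sum
open import Data.Empty using (⊥; ⊥-elim)
open import Function.Base using (_∘_; case_of_)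
open import Function.Bundles using (Equivalence)
open import Relation.Binary.Construct.Closure.ReflexiveTransitive using (Star; ε; _◅_; _◅◅_; reverse)
import Relation.Binary.Construct.Closure.ReflexiveTransitive as Star
open import Relation.Binary.PropositionalEquality
  using (_≡_; _≢_; refl; trans; cong; cong₂; subst; module ≡-Reasoning)
open import Relation.Nullary using (¬_; yes; no)
open import Relation.Nullary.Decidable using (⌊_⌋; toWitness; fromWitness)

∧-true⁻ : ∀ {a b} → a ∧ b ≡ true → a ≡ true × b ≡ true
∧-true⁻ {a} {b} h = ∧-conicalˡ a b h , ∧-conicalʳ a b h

∧-true⁺ : ∀ {a b} → a ≡ true → b ≡ true → a ∧ b ≡ true
∧-true⁺ refl refl = refl

∨-true⁻ : ∀ {a b} → a ∨ b ≡ true → a ≡ true ⊎ b ≡ true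
∨-true⁻ {true}  _      = inj₁ refl
∨-true⁻ {false} b≡true = inj₂ b≡true

∨-true⁺ : ∀ {a b} → a ≡ true ⊎ b ≡ true → a ∨ b ≡ true
∨-true⁺ {true}  _             = refl
∨-true⁺ {false} (inj₂ b≡true) = b≡true

any-true⁻ : ∀ {A : Set} (p : A → Bool) xs → any p xs ≡ true → ∃ λ x → p x ≡ true
any-true⁻ p xs h = Prod.map₂ (Equivalence.to T-≡) (satisfied (any⁻ p xs (Equivalence.from T-≡ h)))

any-true⁺ : ∀ {A : Set} (p : A → Bool) {x xs} → x ∈ xs → p x ≡ true → any p xs ≡ true
any-true⁺ p x∈xs px = Equivalence.to T-≡ (any⁺ p (lose x∈xs (Equivalence.from T-≡ px)))

≟-sound : ∀ {m} {x y : Fin m} → ⌊ x ≟ y ⌋ ≡ true → x ≡ y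
≟-sound h = toWitness (Equivalence.from T-≡ h)

≟-complete : ∀ {m} {x y : Fin m} → x ≡ y → ⌊ x ≟ y ⌋ ≡ true
≟-complete x≡y = Equivalence.to T-≡ (fromWitness x≡y)

maxList-lub : ∀ {B xs} → All (_≤ B) xs → maxList xs ≤ B
maxList-lub = foldr-preservesᵇ ⊔-lub z≤n

≤-maxList : ∀ {x xs} → x ∈ xs → x ≤ maxList xs
≤-maxList x∈xs =
  foldr-preservesᵒ (λ a b → [ m≤n⇒m≤n⊔o b , m≤n⇒m≤o⊔n a ]′) 0 _ (inj₂ (lose x∈xs ≤-refl))

sum-map-mono : ∀ {A : Set} {f g : A → ℕ} → (∀ x → f x ≤ g x) →
               ∀ xs → sum (map f xs) ≤ sum (map g xs)
sum-map-mono f≤g []       = z≤n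
sum-map-mono f≤g (x ∷ xs) = +-mono-≤ (f≤g x) (sum-map-mono f≤g xs)

sum-map-≤-+ : ∀ {A : Set} {f g h : A → ℕ} → (∀ x → f x ≤ g x ℕ.+ h x) →
              ∀ xs → sum (map f xs) ≤ sum (map g xs) ℕ.+ sum (map h xs)
sum-map-≤-+ f≤g+h []                   = z≤n
sum-map-≤-+ {g = g} {h} f≤g+h (x ∷ xs) = begin
  _                                                     ≤⟨ +-mono-≤ (f≤g+h x) (sum-map-≤-+ f≤g+h xs) ⟩
  (g x ℕ.+ h x) ℕ.+ (sum (map g xs) ℕ.+ sum (map h xs)) ≡⟨ interchange (g x) (h x) _ _ ⟩
  _                                                     ∎
  where open ≤-Reasoning

indicator : Bool → ℕ
indicator b = if b then 1 else 0

indicator-mono : ∀ {a b} → (a ≡ true → b ≡ true) → indicator a ≤ indicator b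
indicator-mono {false} _                     = z≤n
indicator-mono {true}  a⇒b rewrite a⇒b refl = ≤-refl

indicator-≤-+ : ∀ {a b c} → (a ≡ true → b ≡ true ⊎ c ≡ true) →
                indicator a ≤ indicator b ℕ.+ indicator c
indicator-≤-+ {false}                _ = z≤n
indicator-≤-+ {true} {true}          _ = s≤s z≤n
indicator-≤-+ {true} {false} {true}  _ = ≤-refl
indicator-≤-+ {true} {false} {false} a⇒b∨c with a⇒b∨c refl
... | inj₁ ()
... | inj₂ ()

countPairs-mono : ∀ {m} {P Q : Fin m → Fin m → Bool} →
                  (∀ x y → P x y ≡ true → Q x y ≡ true) → countPairs P ≤ countPairs Q
countPairs-mono {m} P⊆Q = sum-map-mono (λ x → sum-map-mono (λ y → indicator-mono λ h →
  let x<y , Pxy = ∧-true⁻ h in ∧-true⁺ x<y (P⊆Q x y Pxy)) (allFin m)) (allFin m)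

countPairs-≤-+ : ∀ {m} {P Q R : Fin m → Fin m → Bool} →
                 (∀ x y → P x y ≡ true → Q x y ≡ true ⊎ R x y ≡ true) →
                 countPairs P ≤ countPairs Q ℕ.+ countPairs R
countPairs-≤-+ {m} P⊆Q∪R = sum-map-≤-+ (λ x → sum-map-≤-+ (λ y → indicator-≤-+ λ h →
  let x<y , Pxy = ∧-true⁻ h in Sum.map (∧-true⁺ x<y) (∧-true⁺ x<y) (P⊆Q∪R x y Pxy))
  (allFin m)) (allFin m)

Crosses : ∀ {m} → ESet m → VSet m → VSet m → Fin m → Fin m → Bool
Crosses E A B x y = E x y ∧ ((A x ∧ B y) ∨ (A y ∧ B x))

Crosses⁻ : ∀ {m} {E : ESet m} {A B x y} → Crosses E A B x y ≡ true →
           E x y ≡ true × (A x ≡ true × B y ≡ true ⊎ A y ≡ true × B x ≡ true)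
Crosses⁻ h = let Exy , sides = ∧-true⁻ h in Exy , Sum.map ∧-true⁻ ∧-true⁻ (∨-true⁻ sides)

Crosses⁺ : ∀ {m} {E : ESet m} {A B x y} → E x y ≡ true →
           A x ≡ true × B y ≡ true ⊎ A y ≡ true × B x ≡ true → Crosses E A B x y ≡ true
Crosses⁺ Exy sides = ∧-true⁺ Exy (∨-true⁺ (Sum.map (uncurry ∧-true⁺) (uncurry ∧-true⁺) sides))

CrossesCut : ∀ {m} → ESet m → ESet m → Fin m → Fin m → Fin m → Fin m → Bool
CrossesCut E T u v = Crosses E (reach (removeEdge T u v) u) (reach (removeEdge T u v) v)

congestion-lub : ∀ {m} {E T : ESet m} {B} →
                 (∀ u v → (toℕ u <ᵇ toℕ v) ≡ true → T u v ≡ true → edgeCongestion E T u v ≤ B) →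
                 congestion E T ≤ B
congestion-lub {m} bound = maxList-lub (map⁺ (universal (λ u → maxList-lub (map⁺ (universal (λ v →
  entry-≤ (λ h → let u<v , Tuv = ∧-true⁻ h in bound u v u<v Tuv)) (allFin m)))) (allFin m)))
  where
  entry-≤ : ∀ {b n B} → (b ≡ true → n ≤ B) → (if b then n else 0) ≤ B
  entry-≤ {false} _   = z≤n
  entry-≤ {true}  n≤B = n≤B refl

edgeCongestion≤congestion : ∀ {m} {E T : ESet m} {u v} → (toℕ u <ᵇ toℕ v) ≡ true → T u v ≡ true →
                            edgeCongestion E T u v ≤ congestion E T
edgeCongestion≤congestion {m} {E} {T} {u} {v} u<v Tuv = begin
  edgeCongestion E T u v             ≡⟨ cong (if_then edgeCongestion E T u v else 0) (∧-true⁺ u<v Tuv) ⟨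
  entry u v                          ≤⟨ ≤-maxList (∈-map⁺ (entry u) (∈-allFin v)) ⟩
  maxList (map (entry u) (allFin m)) ≤⟨ ≤-maxList (∈-map⁺ (λ u → maxList (map (entry u) (allFin m)))
                                                           (∈-allFin u)) ⟩
  congestion E T                     ∎
  where
  open ≤-Reasoning
  entry : Fin m → Fin m → ℕ
  entry u v = if (toℕ u <ᵇ toℕ v) ∧ T u v then edgeCongestion E T u v else 0

Walk : ∀ {m} → ESet m → Fin m → Fin m → Set
Walk E = Star (λ x y → E x y ≡ true)

reachIn-refl : ∀ {m} k {E : ESet m} {u} → reachIn k E u u ≡ true
reachIn-refl zero    = ≟-complete refl
reachIn-refl (suc k) = ∨-true⁺ (inj₁ (reachIn-refl k))

reachIn-suc⁺ : ∀ {m} k {E : ESet m} {u w v} → reachIn k E u w ≡ true → E w v ≡ true →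
               reachIn (suc k) E u v ≡ true
reachIn-suc⁺ k {E} {u} {w} {v} h Ewv =
  ∨-true⁺ (inj₂ (any-true⁺ (λ w → reachIn k E u w ∧ E w v) (∈-allFin w) (∧-true⁺ h Ewv)))

reachIn-suc⁻ : ∀ {m} k {E : ESet m} {u v} → reachIn (suc k) E u v ≡ true →
               reachIn k E u v ≡ true ⊎ ∃ λ w → reachIn k E u w ≡ true × E w v ≡ true
reachIn-suc⁻ {m} k h = Sum.map₂ (Prod.map₂ ∧-true⁻ ∘ any-true⁻ _ (allFin m)) (∨-true⁻ h)

reachIn⇒Walk : ∀ {m} k {E : ESet m} {u v} → reachIn k E u v ≡ true → Walk E u v
reachIn⇒Walk zero h with refl ← ≟-sound h = ε
reachIn⇒Walk (suc k) h with reachIn-suc⁻ k h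
... | inj₁ r             = reachIn⇒Walk k r
... | inj₂ (w , r , Ewv) = reachIn⇒Walk k r ◅◅ (Ewv ◅ ε)

reach⇒Walk : ∀ {m} {E : ESet m} {u v} → reach E u v ≡ true → Walk E u v
reach⇒Walk {m} = reachIn⇒Walk m

SameEdge : ∀ {m} → Fin m → Fin m → Fin m → Fin m → Set
SameEdge u v x y = (x ≡ u × y ≡ v) ⊎ (x ≡ v × y ≡ u)

sameEdgeᵇ : ∀ {m} → Fin m → Fin m → Fin m → Fin m → Bool
sameEdgeᵇ u v x y = (⌊ x ≟ u ⌋ ∧ ⌊ y ≟ v ⌋) ∨ (⌊ x ≟ v ⌋ ∧ ⌊ y ≟ u ⌋)

sameEdgeᵇ-sound : ∀ {m} {u v x y : Fin m} → sameEdgeᵇ u v x y ≡ true → SameEdge u v x y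
sameEdgeᵇ-sound h =
  Sum.map (Prod.map ≟-sound ≟-sound ∘ ∧-true⁻) (Prod.map ≟-sound ≟-sound ∘ ∧-true⁻) (∨-true⁻ h)

sameEdgeᵇ-complete : ∀ {m} {u v x y : Fin m} → SameEdge u v x y → sameEdgeᵇ u v x y ≡ true
sameEdgeᵇ-complete s = ∨-true⁺ (Sum.map both both s)
  where
  both : ∀ {m} {a b c d : Fin m} → a ≡ b × c ≡ d → ⌊ a ≟ b ⌋ ∧ ⌊ c ≟ d ⌋ ≡ true
  both (a≡b , c≡d) = ∧-true⁺ (≟-complete a≡b) (≟-complete c≡d)

sameEdgeᵇ-swap : ∀ {m} {u v x y : Fin m} → sameEdgeᵇ u v x y ≡ sameEdgeᵇ u v y x
sameEdgeᵇ-swap {u = u} {v} {x} {y} = begin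
  (⌊ x ≟ u ⌋ ∧ ⌊ y ≟ v ⌋) ∨ (⌊ x ≟ v ⌋ ∧ ⌊ y ≟ u ⌋)
    ≡⟨ ∨-comm (⌊ x ≟ u ⌋ ∧ ⌊ y ≟ v ⌋) _ ⟩
  (⌊ x ≟ v ⌋ ∧ ⌊ y ≟ u ⌋) ∨ (⌊ x ≟ u ⌋ ∧ ⌊ y ≟ v ⌋)
    ≡⟨ cong₂ _∨_ (∧-comm ⌊ x ≟ v ⌋ _) (∧-comm ⌊ x ≟ u ⌋ _) ⟩
  (⌊ y ≟ u ⌋ ∧ ⌊ x ≟ v ⌋) ∨ (⌊ y ≟ v ⌋ ∧ ⌊ x ≟ u ⌋)
    ∎
  where open ≡-Reasoning

removeEdge-⊆ : ∀ {m} {T : ESet m} {u v} → removeEdge T u v ⊆E T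
removeEdge-⊆ {T = T} x y h = ∧-conicalˡ (T x y) _ h

removeEdge-mono : ∀ {m} {T T′ : ESet m} {u v} → T ⊆E T′ → removeEdge T u v ⊆E removeEdge T′ u v
removeEdge-mono T⊆T′ x y h = let Txy , kept = ∧-true⁻ h in ∧-true⁺ (T⊆T′ x y Txy) kept

removeEdge-removes : ∀ {m} {T : ESet m} {u v x y} → removeEdge T u v x y ≡ true → ¬ SameEdge u v x y
removeEdge-removes {T = T} {x = x} {y} h s =
  case subst (λ b → not b ≡ true) (sameEdgeᵇ-complete s) (∧-conicalʳ (T x y) _ h) of λ ()

removeEdge-dichotomy : ∀ {m} {T : ESet m} {u v x y} → T x y ≡ true →
                       removeEdge T u v x y ≡ true ⊎ SameEdge u v x y
removeEdge-dichotomy {T = T} {u} {v} {x} {y} Txy with sameEdgeᵇ u v x y in eq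
... | true  = inj₂ (sameEdgeᵇ-sound eq)
... | false = inj₁ (trans (∧-identityʳ (T x y)) Txy)

removeEdge-symmetric : ∀ {m} {T : ESet m} {u v} → Symmetric T → Symmetric (removeEdge T u v)
removeEdge-symmetric {u = u} {v} T-sym x y =
  cong₂ (λ t s → t ∧ not s) (T-sym x y) (sameEdgeᵇ-swap {u = u} {v} {x} {y})

reachIn-removeEdge-split : ∀ {m} k {E : ESet m} {u v x} → reachIn k E u x ≡ true →
  reachIn k (removeEdge E u v) u x ≡ true ⊎ reachIn k (removeEdge E u v) v x ≡ true
reachIn-removeEdge-split zero h = inj₁ h
reachIn-removeEdge-split (suc k) {E} {u} {v} h with reachIn-suc⁻ k h
... | inj₁ r = Sum.map (∨-true⁺ ∘ inj₁) (∨-true⁺ ∘ inj₁) (reachIn-removeEdge-split k r)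
... | inj₂ (w , r , Ewx) with removeEdge-dichotomy {T = E} {u} {v} Ewx
...   | inj₁ E′wx              =
  Sum.map (λ r′ → reachIn-suc⁺ k r′ E′wx) (λ r′ → reachIn-suc⁺ k r′ E′wx) (reachIn-removeEdge-split k r)
...   | inj₂ (inj₁ (_ , refl)) = inj₂ (reachIn-refl (suc k))
...   | inj₂ (inj₂ (_ , refl)) = inj₁ (reachIn-refl (suc k))

data Path {m} (E : ESet m) : Fin m → Fin m → List (Fin m) → Set where
  stop : ∀ {v} → Path E v v []
  step : ∀ {u w v ws} → E u w ≡ true → Path E w v ws → Path E u v (w ∷ ws)

Path-map : ∀ {m} {E E′ : ESet m} {u v ws} → E ⊆E E′ → Path E u v ws → Path E′ u v ws
Path-map E⊆E′ stop         = stop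
Path-map E⊆E′ (step Euw p) = step (E⊆E′ _ _ Euw) (Path-map E⊆E′ p)

Path⇒Linked : ∀ {m} {E : ESet m} {u v z ws} → Path E u v ws → E v z ≡ true →
              Linked (λ x y → E x y ≡ true) (u ∷ ws ++ [ z ])
Path⇒Linked stop         Evz = Evz ∷ [-]
Path⇒Linked (step Euw p) Evz = Euw ∷ Path⇒Linked p Evz

Path-suffix : ∀ {m} {E : ESet m} {w v a ws} → Path E w v ws → Unique (w ∷ ws) → a ∈ w ∷ ws →
              ∃ λ ys → Path E a v ys × Unique (a ∷ ys)
Path-suffix p          uq       (here refl)  = _ , p , uq
Path-suffix (step _ p) (_ ∷ uq) (there a∈ws) = Path-suffix p uq a∈ws

Walk⇒Path : ∀ {m} {E : ESet m} {u v} → Walk E u v → ∃ λ ws → Path E u v ws × Unique (u ∷ ws)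
Walk⇒Path ε = [] , stop , [] ∷ []
Walk⇒Path {u = u} (_◅_ {j = w} Euw walk) with Walk⇒Path walk
... | ws , p , uq with any? (u ≟_) (w ∷ ws)
...   | yes u∈ = Path-suffix p uq u∈
...   | no  u∉ = w ∷ ws , step Euw p , ¬Any⇒All¬ _ u∉ ∷ uq

Acyclic⇒¬Walk-removeEdge : ∀ {m} {T : ESet m} {u v} → Acyclic T → T u v ≡ true → u ≢ v →
                           ¬ Walk (removeEdge T u v) v u
Acyclic⇒¬Walk-removeEdge {T = T} {u} {v} acyclic Tuv u≢v walk with Walk⇒Path walk
... | _  , stop , _                  = u≢v refl
... | _  , step e stop , _           = removeEdge-removes {T = T} {u} {v} e (inj₂ (refl , refl))
... | ws , p@(step _ (step _ _)) , uq =
  acyclic (v ∷ ws) (s≤s (s≤s z≤n) , uq , Path⇒Linked (Path-map removeEdge-⊆ p) Tuv)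

removeEdge-separates : ∀ {m} {T : ESet m} {u v a b} → Symmetric T → Acyclic T → T u v ≡ true → u ≢ v →
                       Walk (removeEdge T u v) u a → Walk (removeEdge T u v) v b →
                       ¬ Walk (removeEdge T u v) a b
removeEdge-separates {T = T} {u} {v} T-sym acyclic Tuv u≢v ua vb ab =
  Acyclic⇒¬Walk-removeEdge acyclic Tuv u≢v (vb ◅◅ reverse flip ab ◅◅ reverse flip ua)
  where
  flip : ∀ {x y} → removeEdge T u v x y ≡ true → removeEdge T u v y x ≡ true
  flip {x} {y} = subst (_≡ true) (removeEdge-symmetric T-sym x y)

module _ {m k} (H : Graph m) {F : ESet m} {C : Fin k → VSet m} {Ts : Fin k → ESet m} {T : ESet m}
  (components  : AreComponents (minusEdges H F) C)
  (Ts-spanning : ∀ i → SpanningTree (C i) (restrictE (minusEdges H F) (C i)) (Ts i))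
  (T-spanning  : SpanningTree allV (adj H) T)
  (Ts⊆T        : ∀ i → Ts i ⊆E T)
  (T⊆Ts∪F      : ∀ x y → T x y ≡ true → Σ (Fin k) (λ i → Ts i x y ≡ true) ⊎ F x y ≡ true)
  where

  private
    E′ : ESet m
    E′ = minusEdges H F

    tree-edge-≢ : ∀ {u v} → T u v ≡ true → u ≢ v
    tree-edge-≢ {u} Tuv refl =
      case subst (_≡ true) (irrefl H u) (proj₁ (proj₂ T-spanning) u u Tuv) of λ ()

    tree-edge-separates : ∀ {u v a b} → T u v ≡ true →
                          Walk (removeEdge T u v) u a → Walk (removeEdge T u v) v b →
                          ¬ Walk (removeEdge T u v) a b
    tree-edge-separates Tuv =
      removeEdge-separates (proj₁ T-spanning) (proj₂ (proj₂ (proj₂ T-spanning))) Tuv (tree-edge-≢ Tuv)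

    component : ∀ {x y} → E′ x y ≡ true → ∃ λ j → C j x ≡ true × C j y ≡ true
    component {x} {y} E′xy =
      let j , Cjx = proj₂ (proj₂ components) x
      in  j , Cjx , proj₂ (proj₂ (proj₁ components j)) x y Cjx E′xy

    components-disjoint : ∀ {i j x} → C i x ≡ true → C j x ≡ true → i ≡ j
    components-disjoint {i} {j} {x} = proj₁ (proj₂ components) i j x

    Ts-edge : ∀ {j a b} → Ts j a b ≡ true → E′ a b ≡ true × C j a ≡ true × C j b ≡ true
    Ts-edge {j} {a} {b} h = Prod.map₂ ∧-true⁻ (∧-true⁻ (proj₁ (proj₂ (Ts-spanning j)) a b h))

    Ts-reach : ∀ {j x y} → C j x ≡ true → C j y ≡ true → reach (Ts j) x y ≡ true
    Ts-reach {j} {x} {y} = proj₁ (proj₂ (proj₂ (Ts-spanning j))) x y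

    lift-avoiding : ∀ {j u v x y} → Ts j u v ≡ false → Walk (Ts j) x y → Walk (removeEdge T u v) x y
    lift-avoiding {j} {u} {v} Ts∌uv = Star.map keep
      where
      keep : ∀ {a b} → Ts j a b ≡ true → removeEdge T u v a b ≡ true
      keep {a} {b} Tsab with removeEdge-dichotomy {T = T} {u} {v} (Ts⊆T j a b Tsab)
      ... | inj₁ kept                 = kept
      ... | inj₂ (inj₁ (refl , refl)) = case subst (_≡ true) Ts∌uv Tsab of λ ()
      ... | inj₂ (inj₂ (refl , refl)) =
        case subst (_≡ true) (trans (proj₁ (Ts-spanning j) v u) Ts∌uv) Tsab of λ ()

    lift-removeEdge : ∀ {j u v x y} → Walk (removeEdge (Ts j) u v) x y → Walk (removeEdge T u v) x y
    lift-removeEdge {j} = Star.map (removeEdge-mono (Ts⊆T j) _ _)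

    component-unsplit : ∀ {j u v a b} → Ts j u v ≡ false → T u v ≡ true → C j a ≡ true → C j b ≡ true →
                        reach (removeEdge T u v) u a ≡ true → reach (removeEdge T u v) v b ≡ true → ⊥
    component-unsplit Ts∌uv Tuv Cja Cjb ua vb =
      tree-edge-separates Tuv (reach⇒Walk ua) (reach⇒Walk vb)
        (lift-avoiding Ts∌uv (reach⇒Walk (Ts-reach Cja Cjb)))

    component-sides : ∀ {j u v a b} → Ts j u v ≡ true → T u v ≡ true → C j a ≡ true → C j b ≡ true →
                      reach (removeEdge T u v) u a ≡ true × reach (removeEdge T u v) v b ≡ true →
                      reach (removeEdge (Ts j) u v) u a ≡ true × reach (removeEdge (Ts j) u v) v b ≡ true
    component-sides {j} {u} {v} {a} {b} Tsuv Tuv Cja Cjb (ua , vb) = a-side , b-side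
      where
      Cju : C j u ≡ true
      Cju = proj₁ (proj₂ (Ts-edge Tsuv))
      a-side : reach (removeEdge (Ts j) u v) u a ≡ true
      a-side with reachIn-removeEdge-split m (Ts-reach Cju Cja)
      ... | inj₁ r = r
      ... | inj₂ r = ⊥-elim (tree-edge-separates Tuv (reach⇒Walk ua) (lift-removeEdge (reach⇒Walk r)) ε)
      b-side : reach (removeEdge (Ts j) u v) v b ≡ true
      b-side with reachIn-removeEdge-split m (Ts-reach Cju Cjb)
      ... | inj₁ r = ⊥-elim (tree-edge-separates Tuv (lift-removeEdge (reach⇒Walk r)) (reach⇒Walk vb) ε)
      ... | inj₂ r = r

    crossing∉F⇒component-crossing :
      ∀ {u v x y} → T u v ≡ true → CrossesCut (adj H) T u v x y ≡ true → F x y ≡ false →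
      ∃ λ j → Ts j u v ≡ true × CrossesCut (restrictE E′ (C j)) (Ts j) u v x y ≡ true
    crossing∉F⇒component-crossing {u} {v} Tuv c ¬Fxy with Crosses⁻ {E = adj H} c
    ... | Hxy , sides with component (∧-true⁺ Hxy (cong not ¬Fxy))
    ... | j , Cjx , Cjy = j , Tsuv , Crosses⁺ {E = restrictE E′ (C j)}
      (∧-true⁺ (∧-true⁺ Hxy (cong not ¬Fxy)) (∧-true⁺ Cjx Cjy))
      (Sum.map (component-sides Tsuv Tuv Cjx Cjy) (component-sides Tsuv Tuv Cjy Cjx) sides)
      where
      -- Otherwise the T_j-path from x to y avoids uv and joins the two sides of T − uv.
      Tsuv : Ts j u v ≡ true
      Tsuv = ¬-not λ Ts∌uv →
        [ uncurry (component-unsplit Ts∌uv Tuv Cjx Cjy) , uncurry (component-unsplit Ts∌uv Tuv Cjy Cjx) ]′ sides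

    F-edge-crossing⊆F : ∀ {u v x y} → F u v ≡ true → T u v ≡ true →
                        CrossesCut (adj H) T u v x y ≡ true → F x y ≡ true
    F-edge-crossing⊆F {x = x} {y} Fuv Tuv c with F x y ≟ᵇ true
    ... | yes Fxy = Fxy
    ... | no ¬Fxy =
      let _ , Tsuv , _ = crossing∉F⇒component-crossing Tuv c (¬-not ¬Fxy)
      in  case subst (λ b → not b ≡ true) Fuv (∧-conicalʳ _ _ (proj₁ (Ts-edge Tsuv))) of λ ()

    Ts-edge-crossing⊆crossingᵢ∪F : ∀ {i u v x y} → Ts i u v ≡ true → T u v ≡ true →
                                   CrossesCut (adj H) T u v x y ≡ true →
                                   CrossesCut (restrictE E′ (C i)) (Ts i) u v x y ≡ true ⊎ F x y ≡ true
    Ts-edge-crossing⊆crossingᵢ∪F {x = x} {y} Tsᵢuv Tuv c with F x y ≟ᵇ true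
    ... | yes Fxy = inj₂ Fxy
    ... | no ¬Fxy with crossing∉F⇒component-crossing Tuv c (¬-not ¬Fxy)
    ...   | j , Tsⱼuv , cⱼ
      with refl ← components-disjoint (proj₁ (proj₂ (Ts-edge Tsⱼuv))) (proj₁ (proj₂ (Ts-edge Tsᵢuv)))
      = inj₁ cⱼ

  congestion-≤-max+numEdges : congestion (adj H) T ≤
    maxList (map (λ i → congestion (restrictE (minusEdges H F) (C i)) (Ts i)) (allFin k)) ℕ.+ numEdges F
  congestion-≤-max+numEdges = congestion-lub edge-bound
    where
    edge-bound : ∀ u v → (toℕ u <ᵇ toℕ v) ≡ true → T u v ≡ true → edgeCongestion (adj H) T u v ≤ _
    edge-bound u v u<v Tuv with T⊆Ts∪F u v Tuv
    ... | inj₂ Fuv        =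
      ≤-trans (countPairs-mono (λ x y → F-edge-crossing⊆F {x = x} {y} Fuv Tuv)) (m≤n+m _ _)
    ... | inj₁ (i , Tsuv) =
      ≤-trans (countPairs-≤-+ (λ x y → Ts-edge-crossing⊆crossingᵢ∪F {x = x} {y} Tsuv Tuv))
        (+-monoˡ-≤ _ (≤-trans (edgeCongestion≤congestion {E = restrictE E′ (C i)} u<v Tsuv)
          (≤-maxList (∈-map⁺ (λ i → congestion (restrictE E′ (C i)) (Ts i)) (∈-allFin i)))))

m≤n+o⇒m/1≤n/1+o/1 : ∀ {m} n o → m ≤ n ℕ.+ o → + m / 1 ≤ℚ + n / 1 + + o / 1
m≤n+o⇒m/1≤n/1+o/1 {m} n o m≤n+o = ℚ.toℚᵘ-cancel-≤ (begin
  toℚᵘ (+ m / 1)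
    ≃⟨ ℚ.toℚᵘ-fromℚᵘ (mkℚᵘ (+ m) 0) ⟩
  mkℚᵘ (+ m) 0
    ≤⟨ *≤* m*1≤[n*1+o*1]*1 ⟩
  mkℚᵘ (+ n) 0 ℚᵘ.+ mkℚᵘ (+ o) 0
    ≃⟨ ℚᵘ.+-cong (ℚ.toℚᵘ-fromℚᵘ (mkℚᵘ (+ n) 0)) (ℚ.toℚᵘ-fromℚᵘ (mkℚᵘ (+ o) 0)) ⟨
  toℚᵘ (+ n / 1) ℚᵘ.+ toℚᵘ (+ o / 1)
    ≃⟨ ℚ.toℚᵘ-homo-+ (+ n / 1) (+ o / 1) ⟨
  toℚᵘ (+ n / 1 + + o / 1)
    ∎)
  where
  open ℚᵘ.≤-Reasoning
  m*1≤[n*1+o*1]*1 : + m ℤ.* + 1 ℤ.≤ (+ n ℤ.* + 1 ℤ.+ + o ℤ.* + 1) ℤ.* + 1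
  m*1≤[n*1+o*1]*1 rewrite ℤ.*-identityʳ (+ m) | ℤ.*-identityʳ (+ n) | ℤ.*-identityʳ (+ o)
                        | ℤ.*-identityʳ (+ n ℤ.+ + o) = ℤ.+≤+ m≤n+o

lemma7 : (n : ℕ) → 1 ≤ n → (α : ℚ) → 1ℚ ≤ℚ α
    → (m : ℕ) (H : Graph m)
    → Σ (Graph n) (λ G → InducedSubgraphOf H G)
    → Connected allV (adj H)
    → (b : ℕ) → IsBisectionWidth H b
    → (S : VSet m) → Balanced23 S
    → ((+ numEdges (cutEdges H S)) / 1) ≤ℚ (α * ((+ b) / 1))
    → (k : ℕ) (C : Fin k → VSet m)
    → AreComponents (minusEdges H (cutEdges H S)) C
    → (Ts : Fin k → ESet m)
    → (∀ i → SpanningTree (C i) (restrictE (minusEdges H (cutEdges H S)) (C i)) (Ts i))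
    → (T : ESet m) → SpanningTree allV (adj H) T
    → (∀ i → Ts i ⊆E T)
    → (∀ x y → T x y ≡ true → Σ (Fin k) (λ i → Ts i x y ≡ true) ⊎ cutEdges H S x y ≡ true)
    → ((+ congestion (adj H) T) / 1)
      ≤ℚ ((+ maxList (map (λ i → congestion (restrictE (minusEdges H (cutEdges H S)) (C i)) (Ts i)) (allFin k))) / 1)
         + α * ((+ b) / 1)
lemma7 _ _ α _ m H _ _ b _ S _ |F|≤αb k C components Ts Ts-spanning T T-spanning Ts⊆T T⊆Ts∪F = begin
  + congestion (adj H) T / 1         ≤⟨ m≤n+o⇒m/1≤n/1+o/1 M (numEdges F) congestion≤M+|F| ⟩
  + M / 1 + + numEdges F / 1         ≤⟨ ℚ.+-monoʳ-≤ (+ M / 1) |F|≤αb ⟩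
  + M / 1 + α * (+ b / 1)            ∎
  where
  open ℚ.≤-Reasoning
  F : ESet m
  F = cutEdges H S
  M : ℕ
  M = maxList (map (λ i → congestion (restrictE (minusEdges H F) (C i)) (Ts i)) (allFin k))
  congestion≤M+|F| : congestion (adj H) T ≤ M ℕ.+ numEdges F
  congestion≤M+|F| = congestion-≤-max+numEdges H components Ts-spanning T-spanning Ts⊆T T⊆Ts∪F
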